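{- Let $G$ be an edge-labelled graph in which every $\Delta$-module is trivial, and suppose $G$ has at least one overlap edge or at least one non-edge (pair of non-adjacent vertices). Then either $G$ has exactly two $\Delta$-implication classes $A$ and $A^{ -1}$ (with $A\neq A^{ -1}$), or $G$ has exactly one $\Delta$-implication class $A$, and $A=A^{ -1}$.
   Context: An edge-labelled graph is a finite graph $G=(V,E)$ with a loop at every vertex, in which every edge is labelled either "inclusion edge" or "overlap edge" (loops are labelled inclusion); labels need not reflect neighbourhoods. $u$ overlaps $v$ if $uv$ is an overlap edge. A vertex $z$ avoids the edge $xy$ (possibly $x=y$) if every neighbour of $z$ among $x,y$ overlaps $z$, and whenever $z$ overlaps both $x$ and $y$, $xy$ is an inclusion edge. Whenever an edge $xy$ avoids $z$ we write $(x,z)\,\Delta\,(y,z)$ and $(z,x)\,\Delta\,(z,y)$. An ordered pair $(a,b)$ is related to $(u,v)$ if there is a sequence $(a,b)=(p_0,q_0)\,\Delta\,(p_1,q_1)\,\Delta\cdots\Delta\,(p_m,q_m)=(u,v)$ with $m\ge 1$. A $\Delta$-implication class is a maximal set of ordered pairs that are pairwise related; $A^{ -1}=\{(u,v):(v,u)\in A\}$. A $\Delta$-module is a set $S\subseteq V$ such that (a) every $x\in V\setminus S$ is either non-adjacent to all vertices of $S$, or joined to every vertex of $S$ by an inclusion edge, or joined to every vertex of $S$ by an overlap edge; and (b) if $S$ is not a clique, no vertex of $V\setminus S$ overlaps a vertex of $S$. A $\Delta$-module $S$ is trivial if $S=V$ or $|S|=1$. -}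

module Defs where

open import Data.Nat using (ℕ)
open import Data.Fin using (Fin)
open import Data.Fin.Subset using (Subset; _∈_; _∉_; ∣_∣; ⊤; Nonempty)
open import Data.Bool using (Bool; true)
open import Data.Product using (_×_; _,_; ∃; ∃-syntax)
open import Data.Sum using (_⊎_)
open import Relation.Nullary using (¬_)
open import Relation.Binary.PropositionalEquality using (_≡_; _≢_)
open import Relation.Binary.Construct.Closure.Transitive using (TransClosure)

data Label : Set where
  none incl ovl : Label

record ELGraph (n : ℕ) : Set where
  field
    lab      : Fin n → Fin n → Label
    lab-sym  : ∀ x y → lab x y ≡ lab y x
    lab-loop : ∀ x → lab x x ≡ incl

module _ {n : ℕ} (G : ELGraph n) where
  open ELGraph G

  Adj : Fin n → Fin n → Set
  Adj x y = lab x y ≢ none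

  Overlaps : Fin n → Fin n → Set
  Overlaps x y = lab x y ≡ ovl

  -- z avoids the edge xy (x = y allowed)
  Avoids : Fin n → Fin n → Fin n → Set
  Avoids z x y =
    (Adj z x → Overlaps z x) × (Adj z y → Overlaps z y) ×
    (Overlaps z x → Overlaps z y → lab x y ≡ incl)

  Pair : Set
  Pair = Fin n × Fin n

  data _Δ_ : Pair → Pair → Set where
    Δ-left  : ∀ {x y z} → Adj x y → Avoids z x y → (x , z) Δ (y , z)
    Δ-right : ∀ {x y z} → Adj x y → Avoids z x y → (z , x) Δ (z , y)

  Related : Pair → Pair → Set
  Related = TransClosure _Δ_

  PairSet : Set
  PairSet = Fin n → Fin n → Bool

  _∈ₚ_ : Pair → PairSet → Set
  (u , v) ∈ₚ A = A u v ≡ true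

  _⊆ₚ_ : PairSet → PairSet → Set
  A ⊆ₚ B = ∀ p → p ∈ₚ A → p ∈ₚ B

  _≐ₚ_ : PairSet → PairSet → Set
  A ≐ₚ B = ∀ u v → A u v ≡ B u v

  inv : PairSet → PairSet
  inv A u v = A v u

  PairwiseRelated : PairSet → Set
  PairwiseRelated A = ∀ p q → p ∈ₚ A → q ∈ₚ A → Related p q

  IsImplicationClass : PairSet → Set
  IsImplicationClass A =
    PairwiseRelated A × (∀ B → A ⊆ₚ B → PairwiseRelated B → B ⊆ₚ A)

  IsClique : Subset n → Set
  IsClique S = ∀ x y → x ∈ S → y ∈ S → Adj x y

  IsΔModule : Subset n → Set
  IsΔModule S =
    (∀ x → x ∉ S →
        (∀ s → s ∈ S → lab x s ≡ none)
      ⊎ (∀ s → s ∈ S → lab x s ≡ incl)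
      ⊎ (∀ s → s ∈ S → lab x s ≡ ovl))
    × (¬ IsClique S → ∀ x s → x ∉ S → s ∈ S → ¬ Overlaps x s)

  TrivialModule : Subset n → Set
  TrivialModule S = S ≡ ⊤ ⊎ ∣ S ∣ ≡ 1

-- Fix a pair (a , b) that is not an inclusion edge, and call a non-inclusion pair (u , v) coloured when it lies
-- in the implication class of (a , b) or of (b , a). For any symmetric relation P on vertices that is preserved
-- by Δ, the P-connected component of a vertex with a P-neighbour is a nontrivial Δ-module, hence the whole
-- vertex set. Applied to "coloured", this gives every vertex a coloured neighbour; a short local analysis
-- then shows that no coloured pair (p , q) has a common uncoloured neighbour v, since moving (p , q) along Δ
-- would carry that configuration to a coloured pair ending at v. Applied to "uncoloured", it would join a to b
-- by a path of uncoloured pairs, which that local fact rules out by induction on the path. So every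
-- non-inclusion pair is coloured, and every implication class is the class of (a , b) or of (b , a).
module Submission where

open import Defs
open import Data.Nat using (ℕ)
open import Data.Nat.Properties using (<-irrefl)
open import Data.Bool using (Bool; true; false)
import Data.Bool as Bool
open import Data.Empty using (⊥; ⊥-elim)
open import Data.Fin using (Fin)
import Data.Fin.Properties as Fin
open import Data.Fin.Subset using (Subset; Nonempty; _∈_; _∉_; ∣_∣; ⊤; ⁅_⁆; _⊂_)
import Data.Fin.Subset.Properties as Subset
open import Data.List using (List; []; _∷_; allFin; cartesianProduct)
open import Data.List.Membership.Propositional using () renaming (_∈_ to _∈ˡ_)
open import Data.List.Membership.Propositional.Properties using (∈-allFin; ∈-cartesianProduct⁺)
open import Data.List.Relation.Unary.Any using (here; there)
open import Data.Product using (_×_; _,_; proj₁; proj₂; ∃; ∃-syntax; uncurry; swap)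
open import Data.Sum using (_⊎_; inj₁; inj₂; [_,_]′) renaming (map to ⊎-map)
open import Data.Vec using (tabulate)
import Data.Vec.Properties as Vec
open import Function.Base using (_∘_)
open import Function.Bundles using (_⇔_; mk⇔; module Equivalence)
open import Level using (_⊔_)
open import Relation.Binary.Core using (Rel)
open import Relation.Binary.Definitions using (Decidable; Symmetric)
open import Relation.Binary.PropositionalEquality using (_≡_; _≢_; refl; sym; trans; subst)
open import Relation.Binary.Construct.Closure.Transitive using (TransClosure; [_]; _∷_; _∷ʳ_; _++_)
import Relation.Binary.Construct.Closure.Transitive as Transitive
open import Relation.Nullary using (¬_; Dec; yes; no; does; contradiction)
open import Relation.Nullary.Decidable using (map′; _×-dec_; _⊎-dec_; _→-dec_; ¬?; dec-true)

open Equivalence using (to; from)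

true-ext : ∀ {b c : Bool} → (b ≡ true → c ≡ true) → (c ≡ true → b ≡ true) → b ≡ c
true-ext {true}  {true}  _ _ = refl
true-ext {true}  {false} f _ = sym (f refl)
true-ext {false} {true}  _ g = g refl
true-ext {false} {false} _ _ = refl

dec-true⁻¹ : ∀ {a} {A : Set a} (a? : Dec A) → does a? ≡ true → A
dec-true⁻¹ (yes x) _ = x

curried-counterexample : ∀ {a b c} {A : Set a} {B : Set b} {C : Set c} →
                         Dec A → Dec B → ¬ (A → B → C) → A × B × ¬ C
curried-counterexample (yes x) (yes y) h = x , y , λ z → h λ _ _ → z
curried-counterexample (yes _) (no ¬y) h = contradiction (λ _ y → contradiction y ¬y) h
curried-counterexample (no ¬x) _       h = contradiction (λ x → contradiction x ¬x) h

∣p∣≡1⇒≡ : ∀ {n} {p : Subset n} {x y} → x ∈ p → y ∈ p → ∣ p ∣ ≡ 1 → x ≡ y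
∣p∣≡1⇒≡ {p = p} {x} {y} x∈p y∈p ∣p∣≡1 with x Fin.≟ y
... | yes x≡y = x≡y
... | no x≢y  = contradiction (Subset.p⊂q⇒∣p∣<∣q∣ ⁅x⁆⊂p)
                             (<-irrefl (trans (Subset.∣⁅x⁆∣≡1 x) (sym ∣p∣≡1)))
  where
  ⁅x⁆⊂p : ⁅ x ⁆ ⊂ p
  ⁅x⁆⊂p = (λ z∈⁅x⁆ → subst (_∈ p) (sym (Subset.x∈⁅y⁆⇒x≡y x z∈⁅x⁆)) x∈p)
        , y , y∈p , Subset.x≢y⇒x∉⁅y⁆ (x≢y ∘ sym)

module _ {n ℓ} {P : Fin n → Set ℓ} (P? : ∀ x → Dec (P x)) where

  subsetOf : Subset n
  subsetOf = tabulate (does ∘ P?)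

  ∈-subsetOf⁺ : ∀ {x} → P x → x ∈ subsetOf
  ∈-subsetOf⁺ {x} px = Vec.lookup⇒[]= x subsetOf (trans (Vec.lookup∘tabulate _ x) (dec-true (P? x) px))

  ∈-subsetOf⁻ : ∀ {x} → x ∈ subsetOf → P x
  ∈-subsetOf⁻ {x} x∈ = dec-true⁻¹ (P? x) (trans (sym (Vec.lookup∘tabulate _ x)) (Vec.[]=⇒lookup x∈))

module _ {a ℓ} {A : Set a} {R : Rel A ℓ} (R? : Decidable R) where

  -- R-paths whose intermediate points all lie in ks; deciding them by recursion on ks is Warshall's algorithm.
  private
    data Via (ks : List A) : A → A → Set (a ⊔ ℓ) where
      direct : ∀ {x y} → R x y → Via ks x y
      step   : ∀ {x z y} → R x z → z ∈ˡ ks → Via ks z y → Via ks x y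

    weaken : ∀ {k ks x y} → Via ks x y → Via (k ∷ ks) x y
    weaken (direct r)     = direct r
    weaken (step r z∈ p) = step r (there z∈) (weaken p)

    concat : ∀ {ks x k y} → Via ks x k → k ∈ˡ ks → Via ks k y → Via ks x y
    concat (direct r)     k∈ q = step r k∈ q
    concat (step r z∈ p) k∈ q = step r z∈ (concat p k∈ q)

    split : ∀ {k ks x y} → Via (k ∷ ks) x y → Via ks x y ⊎ (Via ks x k × Via ks k y)
    split (direct r) = inj₁ (direct r)
    split (step r (here refl) p) with split p
    ... | inj₁ q       = inj₂ (direct r , q)
    ... | inj₂ (_ , q) = inj₂ (direct r , q)
    split (step r (there z∈) p) with split p
    ... | inj₁ q       = inj₁ (step r z∈ q)
    ... | inj₂ (q , s) = inj₂ (step r z∈ q , s)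

    join : ∀ {k ks x y} → Via ks x y ⊎ (Via ks x k × Via ks k y) → Via (k ∷ ks) x y
    join (inj₁ p)       = weaken p
    join (inj₂ (p , q)) = concat (weaken p) (here refl) (weaken q)

    via? : ∀ ks → Decidable (Via ks)
    via? [] x y = map′ direct (λ { (direct r) → r ; (step _ () _) }) (R? x y)
    via? (k ∷ ks) x y = map′ join split (via? ks x y ⊎-dec (via? ks x k ×-dec via? ks k y))

  TransClosure? : (xs : List A) → (∀ x → x ∈ˡ xs) → Decidable (TransClosure R)
  TransClosure? xs complete x y = map′ toTC fromTC (via? xs x y)
    where
    toTC : ∀ {ks x y} → Via ks x y → TransClosure R x y
    toTC (direct r)   = [ r ]
    toTC (step r _ p) = r ∷ toTC p
    fromTC : ∀ {x y} → TransClosure R x y → Via xs x y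
    fromTC [ r ]   = direct r
    fromTC (r ∷ p) = step r (complete _) (fromTC p)

_≟ˡ_ : (l m : Label) → Dec (l ≡ m)
none ≟ˡ none = yes refl
none ≟ˡ incl = no λ ()
none ≟ˡ ovl  = no λ ()
incl ≟ˡ none = no λ ()
incl ≟ˡ incl = yes refl
incl ≟ˡ ovl  = no λ ()
ovl  ≟ˡ none = no λ ()
ovl  ≟ˡ incl = no λ ()
ovl  ≟ˡ ovl  = yes refl

module ΔTheory {n : ℕ} (G : ELGraph n) where
  open ELGraph G

  NonIncl : Fin n → Fin n → Set
  NonIncl x y = lab x y ≢ incl

  NonIncl-sym : ∀ {x y} → NonIncl x y → NonIncl y x
  NonIncl-sym {x} {y} h = h ∘ trans (lab-sym x y)

  NonIncl-irrefl : ∀ {x} → ¬ NonIncl x x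
  NonIncl-irrefl {x} h = h (lab-loop x)

  Adj-sym : ∀ {x y} → Adj G x y → Adj G y x
  Adj-sym {x} {y} h = h ∘ trans (lab-sym x y)

  Adj-refl : ∀ x → Adj G x x
  Adj-refl x e with () ← trans (sym (lab-loop x)) e

  Overlaps-sym : ∀ {x y} → Overlaps G x y → Overlaps G y x
  Overlaps-sym {x} {y} o = trans (lab-sym y x) o

  incl⇒Adj : ∀ {x y} → lab x y ≡ incl → Adj G x y
  incl⇒Adj e e′ with () ← trans (sym e) e′

  ovl⇒Adj : ∀ {x y} → Overlaps G x y → Adj G x y
  ovl⇒Adj o e with () ← trans (sym o) e

  ovl⇒NonIncl : ∀ {x y} → Overlaps G x y → NonIncl x y
  ovl⇒NonIncl o e with () ← trans (sym o) e

  none⇒NonIncl : ∀ {x y} → lab x y ≡ none → NonIncl x y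
  none⇒NonIncl e e′ with () ← trans (sym e) e′

  none⇒¬Overlaps : ∀ {x y} → lab x y ≡ none → ¬ Overlaps G x y
  none⇒¬Overlaps e o with () ← trans (sym e) o

  ¬Adj⇒none : ∀ {x y} → ¬ Adj G x y → lab x y ≡ none
  ¬Adj⇒none {x} {y} ¬xy with lab x y
  ... | none = refl
  ... | incl = contradiction (λ ()) ¬xy
  ... | ovl  = contradiction (λ ()) ¬xy

  Adj∧NonIncl⇒Overlaps : ∀ {x y} → Adj G x y → NonIncl x y → Overlaps G x y
  Adj∧NonIncl⇒Overlaps {x} {y} xy h with lab x y
  ... | none = contradiction refl xy
  ... | incl = contradiction refl h
  ... | ovl  = refl

  Adj? : Decidable (Adj G)
  Adj? x y = ¬? (lab x y ≟ˡ none)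

  Overlaps? : Decidable (Overlaps G)
  Overlaps? x y = lab x y ≟ˡ ovl

  Avoids? : ∀ z x y → Dec (Avoids G z x y)
  Avoids? z x y = (Adj? z x →-dec Overlaps? z x)
           ×-dec (Adj? z y →-dec Overlaps? z y)
           ×-dec (Overlaps? z x →-dec Overlaps? z y →-dec lab x y ≟ˡ incl)

  avoids : ∀ {z x y} → NonIncl z x → NonIncl z y →
           (Overlaps G z x → Overlaps G z y → lab x y ≡ incl) → Avoids G z x y
  avoids zx zy h = (λ a → Adj∧NonIncl⇒Overlaps a zx) , (λ a → Adj∧NonIncl⇒Overlaps a zy) , h

  avoids⇒NonIncl : ∀ {z x} → (Adj G z x → Overlaps G z x) → NonIncl z x
  avoids⇒NonIncl h e = ovl⇒NonIncl (h (incl⇒Adj e)) e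

  Avoids-sym : ∀ {z x y} → Avoids G z x y → Avoids G z y x
  Avoids-sym {z} {x} {y} (zx , zy , h) = zy , zx , λ o o′ → trans (lab-sym y x) (h o′ o)

  Δ-sym : ∀ {p q} → _Δ_ G p q → _Δ_ G q p
  Δ-sym (Δ-left xy z)  = Δ-left (Adj-sym xy) (Avoids-sym z)
  Δ-sym (Δ-right xy z) = Δ-right (Adj-sym xy) (Avoids-sym z)

  Δ-swap : ∀ {p q} → _Δ_ G p q → _Δ_ G (swap p) (swap q)
  Δ-swap (Δ-left xy z)  = Δ-right xy z
  Δ-swap (Δ-right xy z) = Δ-left xy z

  Δ-nonIncl : ∀ {p q} → _Δ_ G p q → uncurry NonIncl p
  Δ-nonIncl (Δ-left _ (zx , _))  = NonIncl-sym (avoids⇒NonIncl zx)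
  Δ-nonIncl (Δ-right _ (zx , _)) = avoids⇒NonIncl zx

  private
    ΔView : Pair G → Pair G → Set
    ΔView (x , z) (y , z′) = z ≡ z′ × Adj G x y × Avoids G z x y
                           ⊎ x ≡ y × Adj G z z′ × Avoids G x z z′

  Δ? : Decidable (_Δ_ G)
  Δ? (x , z) (y , z′) =
    map′ fromView toView ((z Fin.≟ z′ ×-dec Adj? x y ×-dec Avoids? z x y)
                     ⊎-dec (x Fin.≟ y ×-dec Adj? z z′ ×-dec Avoids? x z z′))
    where
    fromView : ∀ {p q} → ΔView p q → _Δ_ G p q
    fromView (inj₁ (refl , xy , av)) = Δ-left xy av
    fromView (inj₂ (refl , xy , av)) = Δ-right xy av
    toView : ∀ {p q} → _Δ_ G p q → ΔView p q
    toView (Δ-left xy av)  = inj₁ (refl , xy , av)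
    toView (Δ-right xy av) = inj₂ (refl , xy , av)

  Related? : Decidable (Related G)
  Related? = TransClosure? Δ? (cartesianProduct (allFin n) (allFin n))
                           (λ (x , y) → ∈-cartesianProduct⁺ (∈-allFin x) (∈-allFin y))

  Related-sym : ∀ {p q} → Related G p q → Related G q p
  Related-sym = Transitive.symmetric (_Δ_ G) Δ-sym

  Related-swap : ∀ {p q} → Related G p q → Related G (swap p) (swap q)
  Related-swap [ d ]   = [ Δ-swap d ]
  Related-swap (d ∷ r) = Δ-swap d ∷ Related-swap r

  Related-nonIncl : ∀ {p q} → Related G p q → uncurry NonIncl p
  Related-nonIncl [ d ]   = Δ-nonIncl d
  Related-nonIncl (d ∷ _) = Δ-nonIncl d

  Related-refl : ∀ {x y} → NonIncl x y → Related G (x , y) (x , y)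
  Related-refl {x} h = [ Δ-left (Adj-refl x) (avoids yx yx λ _ _ → lab-loop x) ]
    where
    yx = NonIncl-sym h

  IsClassOf : Pair G → PairSet G → Set
  IsClassOf c Y = ∀ p → _∈ₚ_ G p Y ⇔ Related G p c

  classOf : Pair G → PairSet G
  classOf c u v = does (Related? (u , v) c)

  classOf-isClassOf : ∀ c → IsClassOf c (classOf c)
  classOf-isClassOf c p = mk⇔ (dec-true⁻¹ (Related? p c)) (dec-true (Related? p c))

  inv-isClassOf : ∀ {c Y} → IsClassOf c Y → IsClassOf (swap c) (inv G Y)
  inv-isClassOf h p = mk⇔ (Related-swap ∘ to (h (swap p))) (from (h (swap p)) ∘ Related-swap)

  isClassOf-resp : ∀ {c c′ Y} → Related G c c′ → IsClassOf c Y → IsClassOf c′ Y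
  isClassOf-resp r h p = mk⇔ (λ p∈ → to (h p) p∈ ++ r) (λ pc′ → from (h p) (pc′ ++ Related-sym r))

  isClassOf-unique : ∀ {c Y Y′} → IsClassOf c Y → IsClassOf c Y′ → _≐ₚ_ G Y Y′
  isClassOf-unique h h′ u v =
    true-ext (from (h′ (u , v)) ∘ to (h (u , v))) (from (h (u , v)) ∘ to (h′ (u , v)))

  isClassOf⇒pairwiseRelated : ∀ {c Y} → IsClassOf c Y → PairwiseRelated G Y
  isClassOf⇒pairwiseRelated h p q p∈ q∈ = to (h p) p∈ ++ Related-sym (to (h q) q∈)

  isClassOf⇒implicationClass : ∀ {c Y} → Related G c c → IsClassOf c Y → IsImplicationClass G Y
  isClassOf⇒implicationClass {c} cc h =
      isClassOf⇒pairwiseRelated h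
    , λ B Y⊆B B-related p p∈B → from (h p) (B-related p c p∈B (Y⊆B c (from (h c) cc)))

  implicationClass-isClassOf : ∀ {B p c} → IsImplicationClass G B → _∈ₚ_ G p B → Related G p c →
                               IsClassOf c B
  implicationClass-isClassOf {B} {p} {c} (B-related , B-maximal) p∈B pc q =
    mk⇔ (λ q∈B → B-related q p q∈B p∈B ++ pc)
        (λ qc → B-maximal (classOf c) B⊆classOf (isClassOf⇒pairwiseRelated class) q (from (class q) qc))
    where
    class = classOf-isClassOf c
    B⊆classOf : _⊆ₚ_ G B (classOf c)
    B⊆classOf q q∈B = from (class q) (B-related q p q∈B p∈B ++ pc)

  implicationClass-nonempty : ∀ {a b B} → NonIncl a b → IsImplicationClass G B → ∃[ p ] _∈ₚ_ G p B
  implicationClass-nonempty {a} {b} {B} ab (_ , B-maximal)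
    with Fin.any? (λ u → Fin.any? (λ v → B u v Bool.≟ true))
  ... | yes (u , v , uv∈B) = (u , v) , uv∈B
  ... | no B-empty = contradiction (a , b , ab∈B) B-empty
    where
    class = classOf-isClassOf (a , b)
    ab∈B : B a b ≡ true
    ab∈B = B-maximal (classOf (a , b)) (λ (u , v) uv∈B → contradiction (u , v , uv∈B) B-empty)
                     (isClassOf⇒pairwiseRelated class) (a , b) (from (class (a , b)) (Related-refl ab))

  Prime : Set
  Prime = ∀ (S : Subset n) → Nonempty S → IsΔModule G S → TrivialModule G S

  module Component (P : Fin n → Fin n → Set) (P? : Decidable P) (P-sym : Symmetric P)
                   (P-nonIncl : ∀ {x y} → P x y → NonIncl x y)
                   (P-Δ : ∀ {p q} → _Δ_ G p q → uncurry P p → uncurry P q) where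

    extend : ∀ {x y z} → P x y → Adj G y z → NonIncl x z →
             (Overlaps G x y → Overlaps G x z → lab y z ≡ incl) → P x z
    extend pxy yz xz h = P-Δ (Δ-right yz (avoids (P-nonIncl pxy) xz h)) pxy

    extend-none : ∀ {x y z} → P x y → lab x z ≡ none → Adj G y z → P x z
    extend-none pxy xz yz = extend pxy yz (none⇒NonIncl xz) (λ _ o → contradiction o (none⇒¬Overlaps xz))

    lab-transfer : ∀ {m m′ w} → P m m′ → ¬ P m w → ¬ P m′ w → lab m w ≡ lab m′ w
    lab-transfer {m} {m′} {w} pmm′ ¬pmw ¬pm′w with lab m w in e | lab m′ w in e′
    ... | none | none = refl
    ... | none | incl = contradiction (extend-none pmm′ e (incl⇒Adj e′)) ¬pmw
    ... | none | ovl  = contradiction (extend-none pmm′ e (ovl⇒Adj e′)) ¬pmw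
    ... | incl | none = contradiction (extend-none (P-sym pmm′) e′ (incl⇒Adj e)) ¬pm′w
    ... | incl | incl = refl
    ... | incl | ovl  = contradiction (extend (P-sym pmm′) (incl⇒Adj e) (ovl⇒NonIncl e′) λ _ _ → e) ¬pm′w
    ... | ovl  | none = contradiction (extend-none (P-sym pmm′) e′ (ovl⇒Adj e)) ¬pm′w
    ... | ovl  | incl = contradiction (extend pmm′ (incl⇒Adj e′) (ovl⇒NonIncl e) λ _ _ → e′) ¬pmw
    ... | ovl  | ovl  = refl

    Overlaps-transfer : ∀ {m m′ w} → P m m′ → ¬ P m w → Overlaps G m w → Overlaps G m′ w →
                        Overlaps G m m′
    Overlaps-transfer {m} {m′} pmm′ ¬pmw mw m′w with lab m m′ in e
    ... | none = contradiction (extend pmm′ (ovl⇒Adj m′w) (ovl⇒NonIncl mw) λ o → contradiction o (none⇒¬Overlaps e))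
                               ¬pmw
    ... | incl = contradiction e (P-nonIncl pmm′)
    ... | ovl  = refl

    Reach : Fin n → Fin n → Set
    Reach x y = x ≡ y ⊎ TransClosure P x y

    Reach? : Decidable Reach
    Reach? x y = x Fin.≟ y ⊎-dec TransClosure? P? (allFin n) ∈-allFin x y

    Reach-snoc : ∀ {x y z} → Reach x y → P y z → Reach x z
    Reach-snoc (inj₁ refl) p = inj₂ [ p ]
    Reach-snoc (inj₂ r)    p = inj₂ (r ∷ʳ p)

    Reach-sym : ∀ {x y} → Reach x y → Reach y x
    Reach-sym (inj₁ refl) = inj₁ refl
    Reach-sym (inj₂ r)    = inj₂ (Transitive.symmetric P P-sym r)

    Reach-trans : ∀ {x y z} → Reach x y → Reach y z → Reach x z
    Reach-trans (inj₁ refl) r           = r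
    Reach-trans (inj₂ r)    (inj₁ refl) = inj₂ r
    Reach-trans (inj₂ r)    (inj₂ r′)   = inj₂ (r ++ r′)

    component : Fin n → Subset n
    component x = subsetOf (Reach? x)

    module Outside {x w : Fin n} (w∉ : w ∉ component x) where

      ¬P-out : ∀ {u} → Reach x u → ¬ P u w
      ¬P-out r p = w∉ (∈-subsetOf⁺ (Reach? x) (Reach-snoc r p))

      lab-along : ∀ {u t} → Reach x u → TransClosure P u t → lab t w ≡ lab u w
      lab-along r [ p ]     = sym (lab-transfer p (¬P-out r) (¬P-out (Reach-snoc r p)))
      lab-along r (p ∷ ps) =
        trans (lab-along (Reach-snoc r p) ps) (sym (lab-transfer p (¬P-out r) (¬P-out (Reach-snoc r p))))

      lab-uniform : ∀ {t} → Reach x t → lab w t ≡ lab w x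
      lab-uniform (inj₁ refl) = refl
      lab-uniform {t} (inj₂ r) = trans (lab-sym w t) (trans (lab-along (inj₁ refl) r) (lab-sym x w))

      uniform : (∀ s → s ∈ component x → lab w s ≡ none)
              ⊎ (∀ s → s ∈ component x → lab w s ≡ incl)
              ⊎ (∀ s → s ∈ component x → lab w s ≡ ovl)
      uniform with lab w x in e
      ... | none = inj₁ λ s s∈ → trans (lab-uniform (∈-subsetOf⁻ (Reach? x) s∈)) e
      ... | incl = inj₂ (inj₁ λ s s∈ → trans (lab-uniform (∈-subsetOf⁻ (Reach? x) s∈)) e)
      ... | ovl  = inj₂ (inj₂ λ s s∈ → trans (lab-uniform (∈-subsetOf⁻ (Reach? x) s∈)) e)

      module _ (overlapped : ∀ {t} → Reach x t → Overlaps G t w) where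

        none-step : ∀ {u u′ v} → P u u′ → Reach x u → Reach x v → lab u v ≡ none → lab u′ v ≡ none
        none-step puu′ ru rv uv = ¬Adj⇒none λ u′v →
          none⇒¬Overlaps uv
            (Overlaps-transfer (extend-none puu′ uv u′v) (¬P-out ru) (overlapped ru) (overlapped rv))

        none-along : ∀ {u t v} → Reach x u → Reach x v → TransClosure P u t →
                     lab u v ≡ none → lab t v ≡ none
        none-along ru rv [ p ]     uv = none-step p ru rv uv
        none-along ru rv (p ∷ ps) uv = none-along (Reach-snoc ru p) rv ps (none-step p ru rv uv)

      clique : ∀ {s} → s ∈ component x → Overlaps G w s → IsClique G (component x)
      clique {s} s∈ ws u v u∈ v∈ = Reach⇒Adj (Reach-trans (Reach-sym ru) rv)
        where
        ru = ∈-subsetOf⁻ (Reach? x) u∈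
        rv = ∈-subsetOf⁻ (Reach? x) v∈
        overlapped : ∀ {t} → Reach x t → Overlaps G t w
        overlapped {t} rt = trans (lab-sym t w)
          (trans (lab-uniform rt) (trans (sym (lab-uniform (∈-subsetOf⁻ (Reach? x) s∈))) ws))
        Reach⇒Adj : Reach u v → Adj G u v
        Reach⇒Adj (inj₁ refl) = Adj-refl u
        Reach⇒Adj (inj₂ r) uv = Adj-refl v (none-along overlapped ru rv r uv)

    component-isΔModule : ∀ x → IsΔModule G (component x)
    component-isΔModule x = (λ w w∉ → Outside.uniform w∉)
                          , λ ¬clique w s w∉ s∈ ws → ¬clique (Outside.clique w∉ s∈ ws)

    component-full : Prime → ∀ {x y} → P x y → ∀ t → Reach x t
    component-full prime {x} {y} pxy t
      with prime (component x) (x , ∈-subsetOf⁺ (Reach? x) (inj₁ refl)) (component-isΔModule x)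
    ... | inj₁ full   = ∈-subsetOf⁻ (Reach? x) (subst (t ∈_) (sym full) Subset.∈⊤)
    ... | inj₂ single = contradiction (subst (λ z → NonIncl z y) x≡y (P-nonIncl pxy)) NonIncl-irrefl
      where
      x≡y = ∣p∣≡1⇒≡ (∈-subsetOf⁺ (Reach? x) (inj₁ refl)) (∈-subsetOf⁺ (Reach? x) (inj₂ [ pxy ])) single

    neighbour : Prime → ∀ {x y} → P x y → ∀ t → ∃[ s ] P s t
    neighbour prime {x} {y} pxy t with component-full prime pxy t
    ... | inj₁ refl = y , P-sym pxy
    ... | inj₂ r    = last r
      where
      last : ∀ {u} → TransClosure P u t → ∃[ s ] P s t
      last [ p ]    = _ , p
      last (_ ∷ ps) = last ps

  HasTwoInverseClasses : Set
  HasTwoInverseClasses =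
    ∃[ A ] (IsImplicationClass G A × IsImplicationClass G (inv G A) × ¬ (_≐ₚ_ G A (inv G A)) ×
        (∀ B → IsImplicationClass G B → _≐ₚ_ G B A ⊎ _≐ₚ_ G B (inv G A)))

  HasOneSymmetricClass : Set
  HasOneSymmetricClass =
    ∃[ A ] (IsImplicationClass G A × _≐ₚ_ G A (inv G A) ×
        (∀ B → IsImplicationClass G B → _≐ₚ_ G B A))

  module Classification (prime : Prime) {a b : Fin n} (ab : NonIncl a b) where

    InClass : Pair G → Set
    InClass p = Related G p (a , b) ⊎ Related G p (b , a)

    InClass-back : ∀ {p q} → Related G p q → InClass q → InClass p
    InClass-back r = ⊎-map (r ++_) (r ++_)

    C D : Fin n → Fin n → Set
    C u v = InClass (u , v)
    D u v = NonIncl u v × ¬ C u v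

    C? : Decidable C
    C? u v = Related? (u , v) (a , b) ⊎-dec Related? (u , v) (b , a)

    D? : Decidable D
    D? u v = ¬? (lab u v ≟ˡ incl) ×-dec ¬? (C? u v)

    C-sym : Symmetric C
    C-sym (inj₁ r) = inj₂ (Related-swap r)
    C-sym (inj₂ r) = inj₁ (Related-swap r)

    C-nonIncl : ∀ {u v} → C u v → NonIncl u v
    C-nonIncl = [ Related-nonIncl , Related-nonIncl ]′

    C-Δ : ∀ {p q} → _Δ_ G p q → InClass p → InClass q
    C-Δ d = InClass-back [ Δ-sym d ]

    D-sym : Symmetric D
    D-sym (uv , ¬c) = NonIncl-sym uv , ¬c ∘ C-sym

    D-Δ : ∀ {p q} → _Δ_ G p q → uncurry D p → uncurry D q
    D-Δ d (_ , ¬c) = Δ-nonIncl (Δ-sym d) , ¬c ∘ InClass-back [ d ]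

    module C-Component = Component C C? C-sym C-nonIncl C-Δ
    module D-Component = Component D D? D-sym proj₁ D-Δ

    C-ab : C a b
    C-ab = inj₁ (Related-refl ab)

    C-D-apart : ∀ {z y v} → C z y → D z v → Adj G y v → Overlaps G z y × Overlaps G z v × NonIncl y v
    C-D-apart {z} {y} {v} czy (zv , ¬czv) yv =
      curried-counterexample (Overlaps? z y) (Overlaps? z v) (¬czv ∘ C-Component.extend czy yv zv)

    C-D-nonIncl : ∀ {z y v} → C z y → D z v → NonIncl y v
    C-D-nonIncl czy dzv yv = proj₂ (proj₂ (C-D-apart czy dzv (incl⇒Adj yv))) yv

    D-step : ∀ {z x y v} → C z x → Adj G x y → Avoids G z x y → D z v → D x v → D y v
    D-step {z} {x} {y} {v} czx xy zxy dzv dxv = C-D-nonIncl czy dzv , ¬cyv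
      where
      czy : C z y
      czy = C-Δ (Δ-right xy zxy) czx
      ¬cyv : ¬ C y v
      ¬cyv cyv =
        let vy , _ , yx = C-D-apart (C-sym cyv) (D-sym dxv) (Adj-sym xy)
            zy , zv , _ = C-D-apart czy dzv (ovl⇒Adj (Overlaps-sym vy))
            xz , _ , _  = C-D-apart (C-sym czx) dxv (ovl⇒Adj zv)
        in NonIncl-sym yx (proj₂ (proj₂ zxy) (Overlaps-sym xz) zy)

    BothD : Fin n → Pair G → Set
    BothD v (s , t) = D s v × D t v

    BothD-Δ : ∀ {v p q} → _Δ_ G p q → InClass p → BothD v p → BothD v q
    BothD-Δ (Δ-right xy zxy) czx (dzv , dxv) = dzv , D-step czx xy zxy dzv dxv
    BothD-Δ (Δ-left xy zxy)  cxz (dxv , dzv) = D-step (C-sym cxz) xy zxy dzv dxv , dzv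

    BothD-Related : ∀ {v p q} → Related G p q → InClass p → BothD v p → BothD v q
    BothD-Related [ d ]   cp φ = BothD-Δ d cp φ
    BothD-Related (d ∷ r) cp φ = BothD-Related r (C-Δ d cp) (BothD-Δ d cp φ)

    BothD-transfer : ∀ {v p q} → InClass p → InClass q → BothD v p → BothD v q
    BothD-transfer cp cq φ = from-ab cq (to-ab cp φ)
      where
      to-ab : ∀ {v p} → InClass p → BothD v p → BothD v (a , b)
      to-ab cp@(inj₁ r) φ = BothD-Related r cp φ
      to-ab cp@(inj₂ r) φ = swap (BothD-Related r cp φ)
      from-ab : ∀ {v q} → InClass q → BothD v (a , b) → BothD v q
      from-ab (inj₁ r) φ = BothD-Related (Related-sym r) C-ab φ
      from-ab (inj₂ r) φ = BothD-Related (Related-sym r) (C-sym C-ab) (swap φ)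

    no-common-D-neighbour : ∀ {p q v} → C p q → D p v → D q v → ⊥
    no-common-D-neighbour {v = v} cpq dpv dqv with C-Component.neighbour prime C-ab v
    ... | w , cwv = NonIncl-irrefl (proj₁ (proj₂ (BothD-transfer cpq cwv (dpv , dqv))))

    no-D-path : ∀ {p q} → C p q → TransClosure D p q → ⊥
    no-D-path cpq [ dpq ]     = proj₂ dpq cpq
    no-D-path cpq (dpw ∷ ps) = no-common-D-neighbour cpq dpw (D-sym dwq)
      where
      dwq = NonIncl-sym (C-D-nonIncl cpq dpw) , λ cwq → no-D-path cwq ps

    nonIncl⇒C : ∀ {u v} → NonIncl u v → C u v
    nonIncl⇒C {u} {v} uv with C? u v
    ... | yes cuv = cuv
    ... | no ¬cuv = ⊥-elim (no-D-reach (D-Component.Reach-trans (D-Component.Reach-sym (reach a)) (reach b)))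
      where
      reach = D-Component.component-full prime (uv , ¬cuv)
      no-D-reach : D-Component.Reach a b → ⊥
      no-D-reach (inj₁ refl) = NonIncl-irrefl ab
      no-D-reach (inj₂ r)    = no-D-path C-ab r

    implicationClass-cases : ∀ {B} → IsImplicationClass G B → IsClassOf (a , b) B ⊎ IsClassOf (b , a) B
    implicationClass-cases cl with implicationClass-nonempty ab cl
    ... | (u , v) , uv∈B =
      ⊎-map (implicationClass-isClassOf cl uv∈B) (implicationClass-isClassOf cl uv∈B)
            (nonIncl⇒C (Related-nonIncl (proj₁ cl (u , v) (u , v) uv∈B uv∈B)))

    A : PairSet G
    A = classOf (a , b)

    A-class : IsClassOf (a , b) A
    A-class = classOf-isClassOf (a , b)

    A⁻¹-class : IsClassOf (b , a) (inv G A)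
    A⁻¹-class = inv-isClassOf A-class

    two-inverse-classes : ¬ Related G (a , b) (b , a) → HasTwoInverseClasses
    two-inverse-classes ¬ab~ba =
        A , isClassOf⇒implicationClass (Related-refl ab) A-class
      , isClassOf⇒implicationClass (Related-refl (NonIncl-sym ab)) A⁻¹-class , A≢A⁻¹
      , λ B cl → ⊎-map (λ h → isClassOf-unique h A-class) (λ h → isClassOf-unique h A⁻¹-class)
                        (implicationClass-cases cl)
      where
      A≢A⁻¹ : ¬ (_≐ₚ_ G A (inv G A))
      A≢A⁻¹ A≐A⁻¹ = ¬ab~ba (to (A⁻¹-class (a , b))
                                (trans (sym (A≐A⁻¹ a b)) (from (A-class (a , b)) (Related-refl ab))))

    one-symmetric-class : Related G (a , b) (b , a) → HasOneSymmetricClass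
    one-symmetric-class ab~ba =
        A , isClassOf⇒implicationClass (Related-refl ab) A-class , isClassOf-unique A-class′ A⁻¹-class
      , λ B cl → [ (λ h → isClassOf-unique h A-class) , (λ h → isClassOf-unique h A-class′) ]′
                  (implicationClass-cases cl)
      where
      A-class′ : IsClassOf (b , a) A
      A-class′ = isClassOf-resp ab~ba A-class

lemma21 : ∀ {n : ℕ} (G : ELGraph n) →
    (∀ (S : Subset n) → Nonempty S → IsΔModule G S → TrivialModule G S) →
    (∃[ x ] ∃[ y ] (ELGraph.lab G x y ≡ ovl ⊎ ELGraph.lab G x y ≡ none)) →
    (∃[ A ] (IsImplicationClass G A × IsImplicationClass G (inv G A) × ¬ (_≐ₚ_ G A (inv G A)) ×
        (∀ B → IsImplicationClass G B → _≐ₚ_ G B A ⊎ _≐ₚ_ G B (inv G A))))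
    ⊎
    (∃[ A ] (IsImplicationClass G A × _≐ₚ_ G A (inv G A) ×
        (∀ B → IsImplicationClass G B → _≐ₚ_ G B A)))
lemma21 G prime (a , b , lab-ab) = classify (Related? (a , b) (b , a))
  where
  open ΔTheory G
  ab : NonIncl a b
  ab = [ ovl⇒NonIncl , none⇒NonIncl ]′ lab-ab
  open Classification prime ab using (two-inverse-classes; one-symmetric-class)
  classify : Dec (Related G (a , b) (b , a)) → HasTwoInverseClasses ⊎ HasOneSymmetricClass
  classify (yes ab~ba) = inj₂ (one-symmetric-class ab~ba)
  classify (no ¬ab~ba) = inj₁ (two-inverse-classes ¬ab~ba)
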